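{- Let $M$ be a matroid on a finite set $E$ and let $P=\{K_1,\dots,K_t\}$ be a partition of $\bigcup\mathcal{B}(M)$. Then $|B\cap K_i|=1$ for every $B\in\mathcal{B}(M)$ and every $i\in\{1,\dots,t\}$ if and only if $\mathcal{B}(M)=\{\{b_1,\dots,b_t\}: b_i\in K_i,\ 1\le i\le t\}$.
   Context: $\mathcal{B}(M)$ is the family of bases of $M$. A partition of a set $S$ is a family of nonempty pairwise disjoint subsets of $S$ with union $S$. -}

module Defs where

open import Data.Nat using (ℕ)
open import Data.Fin using (Fin)
open import Data.Fin.Subset using (Subset; _∈_; _∉_; _∩_; _∪_; _-_; ⁅_⁆; Nonempty; Empty)
open import Data.Product using (Σ; ∃; _×_; _,_)
open import Relation.Binary.PropositionalEquality using (_≡_)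
open import Relation.Nullary using (¬_)

record Matroid (n : ℕ) : Set₁ where
  field
    IsBasis  : Subset n → Set
    nonempty : ∃ λ B → IsBasis B
    exchange : ∀ {B₁ B₂} → IsBasis B₁ → IsBasis B₂ →
               ∀ {x} → x ∈ B₁ → x ∉ B₂ →
               ∃ λ y → (y ∈ B₂) × (y ∉ B₁) × IsBasis ((B₁ - x) ∪ ⁅ y ⁆)

open Matroid public

InUnionOfBases : ∀ {n} → Matroid n → Fin n → Set
InUnionOfBases M x = ∃ λ B → IsBasis M B × x ∈ B

IsPartitionOfUnionOfBases : ∀ {n t} → Matroid n → (Fin t → Subset n) → Set
IsPartitionOfUnionOfBases {n} {t} M K =
  (∀ i → Nonempty (K i)) ×
  (∀ i j → ¬ (i ≡ j) → Empty (K i ∩ K j)) ×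
  (∀ (x : Fin n) → (InUnionOfBases M x → ∃ λ i → x ∈ K i) ×
                   ((∃ λ i → x ∈ K i) → InUnionOfBases M x))

IsSetOf : ∀ {n t} → (Fin t → Fin n) → Subset n → Set
IsSetOf {n} b B = ∀ (x : Fin n) → (x ∈ B → ∃ λ i → b i ≡ x) × ((∃ λ i → b i ≡ x) → x ∈ B)

-- If every basis meets every block exactly once, then bases are transversals. Conversely a
-- transversal T is reached from an arbitrary basis by swapping, one at a time, an element
-- outside T for the element of T in the same block. Each swap yields a basis: exchanging
-- c ∈ B ∩ K i against a basis D containing b ∈ K i gives a basis (B - c) ∪ ⁅ y ⁆ with y ∈ D;
-- this basis must meet K i, which forces y ∈ K i and hence y = b.
module Submission where

open import Defs
open import Data.Nat using (ℕ; _<_)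
open import Data.Nat.Properties using (<-irrefl)
open import Data.Nat.Induction using (<-wellFounded)
open import Data.Fin using (Fin; zero; suc)
open import Data.Fin.Properties using (_≟_)
open import Data.Fin.Subset
  using (Subset; _∈_; _∉_; _∩_; _∪_; _-_; _─_; ⁅_⁆; ∣_∣; Nonempty; Empty; _⊆_; inside; outside)
open import Data.Fin.Subset.Properties
  using ( x∈p∩q⁺; x∈p∩q⁻; x∈p∪q⁺; x∈p∪q⁻; x∈⁅x⁆; x∈⁅y⁆⇒x≡y; x≢y⇒x∉⁅y⁆; x∉⁅y⁆⇒x≢y; ∣⁅x⁆∣≡1
        ; ∣⊥∣≡0; ⊆-antisym; p⊂q⇒∣p∣<∣q∣; x∈p∧x≢y⇒x∈p-y; x∈p∧x∉q⇒x∈p─q; p─q⊆p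
        ; Empty-unique; nonempty?; _∈?_)
open import Data.Vec.Base using (_∷_; there)
open import Data.Product using (∃; _×_; _,_; proj₁; proj₂)
open import Data.Sum using (_⊎_; inj₁; inj₂)
open import Data.Empty using (⊥-elim)
open import Induction.WellFounded using (Acc; acc)
open import Relation.Binary.PropositionalEquality
open import Relation.Nullary using (yes; no; contradiction)

private
  variable
    n t : ℕ
    p q : Subset n
    x y z : Fin n

x∈p─q⇒x∉q : ∀ (p q : Subset n) → x ∈ p ─ q → x ∉ q
x∈p─q⇒x∉q {x = zero}  (_ ∷ p) (inside  ∷ q) ()
x∈p─q⇒x∉q {x = zero}  (_ ∷ p) (outside ∷ q) _          ()
x∈p─q⇒x∉q {x = suc x} (_ ∷ p) (_       ∷ q) (there x∈) (there x∈q) = x∈p─q⇒x∉q p q x∈ x∈q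

x∈p─q⁻ : x ∈ p ─ q → x ∈ p × x ∉ q
x∈p─q⁻ {p = p} {q} x∈ = p─q⊆p p q x∈ , x∈p─q⇒x∉q p q x∈

Empty[p─q]⇒p⊆q : Empty (p ─ q) → p ⊆ q
Empty[p─q]⇒p⊆q {q = q} empty {x} x∈p with x ∈? q
... | yes x∈q = x∈q
... | no  x∉q = contradiction (x , x∈p∧x∉q⇒x∈p─q x∈p x∉q) empty

x∈p⇒⁅x⁆⊆p : x ∈ p → ⁅ x ⁆ ⊆ p
x∈p⇒⁅x⁆⊆p {x = x} {p} x∈p y∈ = subst (_∈ p) (sym (x∈⁅y⁆⇒x≡y x y∈)) x∈p

∣p∣≡1⇒Nonempty : ∣ p ∣ ≡ 1 → Nonempty p
∣p∣≡1⇒Nonempty {n} {p} ∣p∣≡1 with nonempty? p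
... | yes ne    = ne
... | no  empty with trans (sym ∣p∣≡1) (trans (cong ∣_∣ (Empty-unique empty)) (∣⊥∣≡0 n))
...   | ()

∣p∣≡1⇒x≡y : ∣ p ∣ ≡ 1 → x ∈ p → y ∈ p → x ≡ y
∣p∣≡1⇒x≡y {p = p} {x} {y} ∣p∣≡1 x∈p y∈p with y ≟ x
... | yes y≡x = sym y≡x
... | no  y≢x = ⊥-elim (<-irrefl refl (subst₂ _<_ (∣⁅x⁆∣≡1 x) ∣p∣≡1
                      (p⊂q⇒∣p∣<∣q∣ (x∈p⇒⁅x⁆⊆p x∈p , y , y∈p , x≢y⇒x∉⁅y⁆ y≢x))))

x∈p∧unique⇒∣p∣≡1 : x ∈ p → (∀ {y} → y ∈ p → y ≡ x) → ∣ p ∣ ≡ 1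
x∈p∧unique⇒∣p∣≡1 {x = x} {p} x∈p unique = trans (cong ∣_∣ p≡⁅x⁆) (∣⁅x⁆∣≡1 x)
  where
  p≡⁅x⁆ : p ≡ ⁅ x ⁆
  p≡⁅x⁆ = ⊆-antisym (λ y∈p → subst (_∈ ⁅ x ⁆) (sym (unique y∈p)) (x∈⁅x⁆ x)) (x∈p⇒⁅x⁆⊆p x∈p)

x∈p-y∪⁅z⁆⁻ : x ∈ (p - y) ∪ ⁅ z ⁆ → (x ∈ p × x ≢ y) ⊎ x ≡ z
x∈p-y∪⁅z⁆⁻ {p = p} {y} {z} x∈ with x∈p∪q⁻ (p - y) ⁅ z ⁆ x∈
... | inj₁ x∈p-y = inj₁ (p─q⊆p p ⁅ y ⁆ x∈p-y , x∉⁅y⁆⇒x≢y (x∈p─q⇒x∉q p ⁅ y ⁆ x∈p-y))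
... | inj₂ x∈⁅z⁆ = inj₂ (x∈⁅y⁆⇒x≡y z x∈⁅z⁆)

x∈p⇒p-x∪⁅x⁆≡p : x ∈ p → (p - x) ∪ ⁅ x ⁆ ≡ p
x∈p⇒p-x∪⁅x⁆≡p {x = x} {p} x∈p = ⊆-antisym ⊆p p⊆
  where
  ⊆p : (p - x) ∪ ⁅ x ⁆ ⊆ p
  ⊆p y∈ with x∈p-y∪⁅z⁆⁻ y∈
  ... | inj₁ (y∈p , _) = y∈p
  ... | inj₂ refl      = x∈p
  p⊆ : p ⊆ (p - x) ∪ ⁅ x ⁆
  p⊆ {y} y∈p with y ≟ x
  ... | yes refl = x∈p∪q⁺ (inj₂ (x∈⁅x⁆ x))
  ... | no  y≢x  = x∈p∪q⁺ (inj₁ (x∈p∧x≢y⇒x∈p-y y∈p y≢x))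

∣p-x∪⁅y⁆─q∣<∣p─q∣ : x ∈ p ─ q → y ∈ q → ∣ (p - x) ∪ ⁅ y ⁆ ─ q ∣ < ∣ p ─ q ∣
∣p-x∪⁅y⁆─q∣<∣p─q∣ {x = x} {p} {q} {y} x∈p─q y∈q =
  p⊂q⇒∣p∣<∣q∣ (⊆p─q , x , x∈p─q , x∉)
  where
  ⊆p─q : (p - x) ∪ ⁅ y ⁆ ─ q ⊆ p ─ q
  ⊆p─q z∈ with x∈p─q⁻ z∈
  ... | z∈ , z∉q with x∈p-y∪⁅z⁆⁻ z∈
  ...   | inj₁ (z∈p , _) = x∈p∧x∉q⇒x∈p─q z∈p z∉q
  ...   | inj₂ refl      = contradiction y∈q z∉q
  x∉ : x ∉ (p - x) ∪ ⁅ y ⁆ ─ q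
  x∉ x∈ with x∈p-y∪⁅z⁆⁻ (proj₁ (x∈p─q⁻ x∈))
  ... | inj₁ (_ , x≢x) = x≢x refl
  ... | inj₂ refl      = contradiction y∈q (proj₂ (x∈p─q⁻ x∈p─q))

module _ (M : Matroid n) (K : Fin t → Subset n) (P : IsPartitionOfUnionOfBases M K) where

  IsTransversal : Subset n → Set
  IsTransversal T = ∃ λ b → (∀ i → b i ∈ K i) × IsSetOf b T

  MeetsEveryBlockOnce : Subset n → Set
  MeetsEveryBlockOnce B = ∀ i → ∣ B ∩ K i ∣ ≡ 1

  block-unique : ∀ {i j} → x ∈ K i → x ∈ K j → i ≡ j
  block-unique {x = x} {i} {j} x∈Ki x∈Kj with i ≟ j
  ... | yes i≡j = i≡j
  ... | no  i≢j = ⊥-elim (proj₁ (proj₂ P) i j i≢j (x , x∈p∩q⁺ (x∈Ki , x∈Kj)))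

  basis-element-block : ∀ {B} → IsBasis M B → x ∈ B → ∃ λ i → x ∈ K i
  basis-element-block isB x∈B = proj₁ (proj₂ (proj₂ P) _) (_ , isB , x∈B)

  block-element-basis : ∀ {i} → x ∈ K i → ∃ λ B → IsBasis M B × x ∈ B
  block-element-basis {i = i} x∈K = proj₂ (proj₂ (proj₂ P) _) (i , x∈K)

  transversal⇒meetsEveryBlockOnce : ∀ {T} → IsTransversal T → MeetsEveryBlockOnce T
  transversal⇒meetsEveryBlockOnce {T} (b , b∈K , T≈b) i =
    x∈p∧unique⇒∣p∣≡1 (x∈p∩q⁺ (proj₂ (T≈b (b i)) (i , refl) , b∈K i)) unique
    where
    unique : y ∈ T ∩ K i → y ≡ b i
    unique {y} y∈ with x∈p∩q⁻ T (K i) y∈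
    ... | y∈T , y∈Ki with proj₁ (T≈b y) y∈T
    ...   | j , refl = cong b (block-unique (b∈K j) y∈Ki)

  module _ (bases-meet-once : ∀ B → IsBasis M B → MeetsEveryBlockOnce B) where

    basis-block-unique : ∀ {B i} → IsBasis M B →
                         x ∈ B → x ∈ K i → y ∈ B → y ∈ K i → x ≡ y
    basis-block-unique {B = B} {i} isB x∈B x∈K y∈B y∈K =
      ∣p∣≡1⇒x≡y (bases-meet-once B isB i) (x∈p∩q⁺ (x∈B , x∈K)) (x∈p∩q⁺ (y∈B , y∈K))

    basis-block-element : ∀ {B} → IsBasis M B → ∀ i → ∃ λ x → x ∈ B × x ∈ K i
    basis-block-element {B} isB i with ∣p∣≡1⇒Nonempty (bases-meet-once B isB i)
    ... | x , x∈ = x , x∈p∩q⁻ B (K i) x∈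

    basis⇒transversal : ∀ {B} → IsBasis M B → IsTransversal B
    basis⇒transversal isB =
      (λ i → proj₁ (basis-block-element isB i)) ,
      (λ i → proj₂ (proj₂ (basis-block-element isB i))) ,
      λ x → (λ x∈B → let i , x∈K = basis-element-block isB x∈B
                         _ , bi∈B , bi∈K = basis-block-element isB i
                     in i , basis-block-unique isB bi∈B bi∈K x∈B x∈K) ,
            λ { (i , refl) → proj₁ (proj₂ (basis-block-element isB i)) }

    basis-exchange-within-block : ∀ {B c b i} → IsBasis M B → c ∈ B → c ∈ K i → b ∈ K i →
                                  IsBasis M ((B - c) ∪ ⁅ b ⁆)
    basis-exchange-within-block {B} {c} {b} {i} isB c∈B c∈K b∈K
      with block-element-basis b∈K
    ... | D , isD , b∈D with c ∈? D
    ...   | yes c∈D rewrite basis-block-unique isD c∈D c∈K b∈D b∈K =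
                              subst (IsBasis M) (sym (x∈p⇒p-x∪⁅x⁆≡p c∈B)) isB
    ...   | no  c∉D with exchange M isB isD c∈B c∉D
    ...     | y , y∈D , _ , isB′ = subst (λ y → IsBasis M ((B - c) ∪ ⁅ y ⁆)) y≡b isB′
      where
      y∈K : y ∈ K i
      y∈K with basis-block-element isB′ i
      ... | z , z∈B′ , z∈K with x∈p-y∪⁅z⁆⁻ z∈B′
      ...   | inj₁ (z∈B , z≢c) = contradiction (basis-block-unique isB z∈B z∈K c∈B c∈K) z≢c
      ...   | inj₂ refl        = z∈K
      y≡b : y ≡ b
      y≡b = basis-block-unique isD y∈D y∈K b∈D b∈K

    basis⊆transversal⇒≡ : ∀ {B T} → IsBasis M B → IsTransversal T → B ⊆ T → B ≡ T
    basis⊆transversal⇒≡ {B} {T} isB T-tr@(b , b∈K , T≈b) B⊆T = ⊆-antisym B⊆T T⊆B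
      where
      T⊆B : T ⊆ B
      T⊆B {z} z∈T with proj₁ (T≈b z) z∈T
      ... | i , refl with basis-block-element isB i
      ...   | x , x∈B , x∈K =
        subst (_∈ B) (∣p∣≡1⇒x≡y (transversal⇒meetsEveryBlockOnce T-tr i)
                                 (x∈p∩q⁺ (B⊆T x∈B , x∈K)) (x∈p∩q⁺ (z∈T , b∈K i)))
                     x∈B

    transversal⇒basis : ∀ {T} → IsTransversal T → IsBasis M T
    transversal⇒basis {T} T-tr@(b , b∈K , T≈b) =
      descend (proj₂ (nonempty M)) (<-wellFounded _)
      where
      descend : ∀ {B} → IsBasis M B → Acc _<_ ∣ B ─ T ∣ → IsBasis M T
      descend {B} isB (acc smaller) with nonempty? (B ─ T)
      ... | no  empty =
        subst (IsBasis M) (basis⊆transversal⇒≡ isB T-tr (Empty[p─q]⇒p⊆q empty)) isB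
      ... | yes (x , x∈B─T) =
        let x∈B , _ = x∈p─q⁻ x∈B─T
            i , x∈K = basis-element-block isB x∈B
        in descend (basis-exchange-within-block isB x∈B x∈K (b∈K i))
                   (smaller (∣p-x∪⁅y⁆─q∣<∣p─q∣ x∈B─T (proj₂ (T≈b (b i)) (i , refl))))

theorem9 : ∀ {n t : ℕ} (M : Matroid n) (K : Fin t → Subset n) →
    IsPartitionOfUnionOfBases M K →
    ((∀ B → IsBasis M B → ∀ i → ∣ B ∩ K i ∣ ≡ 1) →
      (∀ B → (IsBasis M B → ∃ λ b → (∀ i → b i ∈ K i) × IsSetOf b B) ×
             ((∃ λ b → (∀ i → b i ∈ K i) × IsSetOf b B) → IsBasis M B)))
    ×
    ((∀ B → (IsBasis M B → ∃ λ b → (∀ i → b i ∈ K i) × IsSetOf b B) ×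
             ((∃ λ b → (∀ i → b i ∈ K i) × IsSetOf b B) → IsBasis M B)) →
      (∀ B → IsBasis M B → ∀ i → ∣ B ∩ K i ∣ ≡ 1))
theorem9 M K P =
  (λ bases-meet-once B → basis⇒transversal M K P bases-meet-once ,
                         transversal⇒basis M K P bases-meet-once) ,
  λ bases≡transversals B isB →
    transversal⇒meetsEveryBlockOnce M K P (proj₁ (bases≡transversals B) isB)
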